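{- Let $k>1$ be an integer and $\sigma$ a permutation of $\{0,1,2,3\}$. Every symmetric $4$-digit $(\sigma,k)$-permutiple $[a_0;a_1,a_2,a_3]$ is continuant-preserving, i.e. $K_4(a_0,a_1,a_2,a_3)=K_4(a_{\sigma(0)},a_{\sigma(1)},a_{\sigma(2)},a_{\sigma(3)})$.
   Context: For positive integers $a_0,\ldots,a_n$, $[a_0;a_1,\ldots,a_n]$ denotes the finite simple continued fraction $a_0+1/(a_1+1/(\cdots+1/a_n))$; all finite continued fractions are assumed in canonical form (last digit at least $2$ when there are at least two digits). For an integer $k>1$ and a permutation $\sigma$ of $\{0,\ldots,n\}$, $r=[a_0;\ldots,a_n]$ is a $(\sigma,k)$-permutiple if $r=k\,[a_{\sigma(0)};a_{\sigma(1)},\ldots,a_{\sigma(n)}]$. It is symmetric if $a_ja_{n-j}=a_{\sigma(j)}a_{\sigma(n-j)}$ for all $0\le j\le n$. Continuants: $K_0()=1$, $K_1(x_0)=x_0$, $K_m(x_0,\ldots,x_{m-1})=x_{m-1}K_{m-1}(x_0,\ldots,x_{m-2})+K_{m-2}(x_0,\ldots,x_{m-3})$. -}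

module Defs where

open import Data.Nat as ℕ using (ℕ; zero; suc)
open import Data.Integer using (+_)
open import Data.Rational using (ℚ; 0ℚ; _+_; 1/_; _≟_; ≢-nonZero)
open import Data.Rational as ℚ using ()
open import Data.List using (List; []; _∷_)
open import Relation.Nullary using (yes; no)

ℕ→ℚ : ℕ → ℚ
ℕ→ℚ n = (+ n) ℚ./ 1

-- Reciprocal, made total by sending 0 to 0 (only ever applied to
-- positive values below, since all digits are positive).
recip : ℚ → ℚ
recip p with p ≟ 0ℚ
... | yes _   = 0ℚ
... | no p≢0  = 1/_ p {{≢-nonZero p≢0}}

-- Value of the finite simple continued fraction [a₀; a₁, …, aₙ]
-- = a₀ + 1/(a₁ + 1/(⋯ + 1/aₙ)).  (Empty list: value 0, never used.)
cf : List ℕ → ℚ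
cf []           = 0ℚ
cf (a ∷ [])     = ℕ→ℚ a
cf (a ∷ b ∷ as) = ℕ→ℚ a + recip (cf (b ∷ as))

K4 : ℕ → ℕ → ℕ → ℕ → ℕ
K4 x₀ x₁ x₂ x₃ = x₃ ℕ.* K3 ℕ.+ K2
  where
  K0 = 1
  K1 = x₀
  K2 = x₁ ℕ.* K1 ℕ.+ K0
  K3 = x₂ ℕ.* K2 ℕ.+ K1

module Submission where

-- Write K for the continuant of a digit list.  For positive digits the
-- continued fraction [a; as] equals K(a ∷ as) / K(as), and this fraction
-- is in lowest terms because consecutive continuants are coprime.  Hence
-- a permutiple equation [a; as] = k·[b; bs] cleared of denominators gives
-- K(a ∷ as)·K(bs) = k·K(b ∷ bs)·K(as), so K(b ∷ bs) divides K(a ∷ as).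
-- Whenever in addition K(a ∷ as) < 2·K(b ∷ bs), the two continuants agree
-- (this part holds for digit lists of any length).
--
-- For four digits K(a₀,a₁,a₂,a₃) = uv + u + 1 + (a₀a₁ + a₂a₃) with
-- u = a₀a₃, v = a₁a₂.  Symmetry of the permutiple fixes u and v, and
-- a₀a₁ + a₂a₃ ≤ uv + 1 while the permuted analogue is at least 2, which
-- yields the bound K(a) < 2·K(aσ) and so the theorem.

open import Defs
open import Data.Nat using (ℕ; _*_; _<_; _≤_)
open import Data.Fin using (Fin; opposite)
open import Data.Fin.Patterns using (0F; 1F; 2F; 3F)
open import Data.Fin.Permutation using (Permutation′; _⟨$⟩ʳ_)
open import Data.List using (_∷_; [])
open import Data.Rational using () renaming (_*_ to _*ℚ_)
open import Relation.Binary.PropositionalEquality using (_≡_)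

open import Data.Nat using (zero; suc; _+_; _∸_; z≤n; s≤s)
import Data.Nat.Properties as ℕP
import Data.Nat.Tactic.RingSolver as ℕSolver
open import Data.Nat.Divisibility using (_∣_; divides; ∣-trans; ∣m+n∣m⇒∣n; n∣m*n; ∣1⇒≡1)
open import Data.Nat.Coprimality using (Coprime; coprime-divisor)
open import Data.Integer as ℤ using (ℤ; +_; +[1+_]; -[1+_])
import Data.Integer.Properties as ℤP
import Data.Integer.Tactic.RingSolver as ℤSolver
open import Data.Rational as ℚ using (mkℚ; toℚᵘ)
open import Data.Rational.Properties using (toℚᵘ-homo-+; toℚᵘ-homo-*; toℚᵘ-fromℚᵘ; toℚᵘ-cong)
open import Data.Rational.Unnormalised as ℚᵘ using (ℚᵘ; mkℚᵘ; *≡*) renaming (_≃_ to _≃ᵘ_)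
open import Data.Rational.Unnormalised.Properties using (≃-trans; ≃-sym; ≃-refl; +-cong; *-cong)
open import Data.List using (List)
open import Data.List.Relation.Unary.All as All using (All)
open import Data.Product using (_,_)
open import Data.Empty using (⊥-elim)
open import Relation.Binary.PropositionalEquality using (sym; trans; cong; cong₂; module ≡-Reasoning)

continuant : List ℕ → ℕ
continuant []           = 1
continuant (x ∷ [])     = x
continuant (x ∷ y ∷ xs) = x * continuant (y ∷ xs) + continuant xs

Positive : List ℕ → Set
Positive = All (1 ≤_)

continuant-pos : ∀ xs → Positive xs → 1 ≤ continuant xs
continuant-pos []           _             = s≤s z≤n
continuant-pos (x ∷ [])     (1≤x All.∷ _) = 1≤x
continuant-pos (x ∷ y ∷ xs) (_ All.∷ ps)  =
  ℕP.≤-trans (continuant-pos xs (All.tail ps)) (ℕP.m≤n+m (continuant xs) (x * continuant (y ∷ xs)))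

-- Consecutive continuants are coprime: a common divisor of K (x ∷ xs) and
-- K xs divides K of the list shortened by one, down to K [] = 1.
continuants-coprime : ∀ x xs → Coprime (continuant (x ∷ xs)) (continuant xs)
continuants-coprime x []       (_ , d∣1)      = ∣1⇒≡1 d∣1
continuants-coprime x (y ∷ ys) (d∣K₀ , d∣K₁) =
  continuants-coprime y ys (d∣K₁ , ∣m+n∣m⇒∣n d∣K₀ (∣-trans d∣K₁ (n∣m*n x)))

-- The unnormalised fraction p / q, meaningful for q ≥ 1.
_÷_ : ℕ → ℕ → ℚᵘ
p ÷ q = mkℚᵘ (+ p) (q ∸ 1)

-- The integer identity behind a + 1/(n/e) = (a·n + d)/m when n·d = m·e
-- (all quantities being numerators and denominators of positive fractions).
add-recip-cross : ∀ (a m n e d : ℤ) → m ℤ.* d ≡ n ℤ.* e →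
                  (a ℤ.* m ℤ.+ e ℤ.* + 1) ℤ.* n ≡ (a ℤ.* n ℤ.+ d) ℤ.* m
add-recip-cross a m n e d md≡ne = begin
  (a ℤ.* m ℤ.+ e ℤ.* + 1) ℤ.* n ≡⟨ expand a m n e ⟩
  a ℤ.* n ℤ.* m ℤ.+ n ℤ.* e     ≡⟨ cong (λ t → a ℤ.* n ℤ.* m ℤ.+ t) (sym md≡ne) ⟩
  a ℤ.* n ℤ.* m ℤ.+ m ℤ.* d     ≡⟨ collect a m n d ⟩
  (a ℤ.* n ℤ.+ d) ℤ.* m         ∎
  where
  open ≡-Reasoning
  expand : ∀ a m n e → (a ℤ.* m ℤ.+ e ℤ.* + 1) ℤ.* n ≡ a ℤ.* n ℤ.* m ℤ.+ n ℤ.* e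
  expand = ℤSolver.solve-∀
  collect : ∀ a m n d → a ℤ.* n ℤ.* m ℤ.+ m ℤ.* d ≡ (a ℤ.* n ℤ.+ d) ℤ.* m
  collect = ℤSolver.solve-∀

add-recip : ∀ a x N D → 1 ≤ N → 1 ≤ D → toℚᵘ x ≃ᵘ N ÷ D →
            toℚᵘ (ℕ→ℚ a ℚ.+ recip x) ≃ᵘ (a * N + D) ÷ N
add-recip a x@(mkℚ +[1+ m ] e _) (suc n) (suc d) _ _ (*≡* md≡ne) =
  ≃-trans (toℚᵘ-homo-+ (ℕ→ℚ a) (recip x))
    (≃-trans (+-cong (toℚᵘ-fromℚᵘ (mkℚᵘ (+ a) 0)) (≃-refl {mkℚᵘ +[1+ e ] m}))
      (*≡* (trans (add-recip-cross (+ a) +[1+ m ] +[1+ n ] +[1+ e ] +[1+ d ] md≡ne)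
                  (cong₂ ℤ._*_ numerator (cong +_ (sym (ℕP.*-identityˡ (suc m))))))))
  where
  numerator : + a ℤ.* +[1+ n ] ℤ.+ +[1+ d ] ≡ + (a * suc n + suc d)
  numerator = trans (cong (ℤ._+ +[1+ d ]) (sym (ℤP.pos-* a (suc n))))
                    (sym (ℤP.pos-+ (a * suc n) (suc d)))
add-recip a (mkℚ (+ zero)   _ _) (suc n) (suc d) _ _ (*≡* ())
add-recip a (mkℚ -[1+ _ ]  _ _) (suc n) (suc d) _ _ (*≡* ())

cf-continuant : ∀ a as → Positive (a ∷ as) →
                toℚᵘ (cf (a ∷ as)) ≃ᵘ continuant (a ∷ as) ÷ continuant as
cf-continuant a []       _          = toℚᵘ-fromℚᵘ (mkℚᵘ (+ a) 0)
cf-continuant a (b ∷ bs) (_ All.∷ ps) =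
  add-recip a (cf (b ∷ bs)) (continuant (b ∷ bs)) (continuant bs)
    (continuant-pos (b ∷ bs) ps) (continuant-pos bs (All.tail ps)) (cf-continuant b bs ps)

cross-multiply : ∀ p q p' q' k → 1 ≤ q → 1 ≤ q' →
                 p ÷ q ≃ᵘ mkℚᵘ (+ k) 0 ℚᵘ.* (p' ÷ q') → p * q' ≡ k * p' * q
cross-multiply p (suc q) p' (suc q') k _ _ (*≡* eq) =
  trans (cong (λ t → p * suc t) (sym (ℕP.+-identityʳ q')))
    (ℤP.+-injective (trans (ℤP.pos-* p _) (trans eq
      (trans (cong (ℤ._* + suc q) (sym (ℤP.pos-* k p'))) (sym (ℤP.pos-* (k * p') (suc q)))))))

permutiple-cross : ∀ k a as b bs → Positive (a ∷ as) → Positive (b ∷ bs) →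
                   cf (a ∷ as) ≡ ℕ→ℚ k *ℚ cf (b ∷ bs) →
                   continuant (a ∷ as) * continuant bs ≡ k * continuant (b ∷ bs) * continuant as
permutiple-cross k a as b bs pa pb value-eq =
  cross-multiply _ _ _ _ k (continuant-pos as (All.tail pa)) (continuant-pos bs (All.tail pb))
    (≃-trans (≃-sym (cf-continuant a as pa))
      (≃-trans (toℚᵘ-cong value-eq)
        (≃-trans (toℚᵘ-homo-* (ℕ→ℚ k) (cf (b ∷ bs)))
          (*-cong (toℚᵘ-fromℚᵘ (mkℚᵘ (+ k) 0)) (cf-continuant b bs pb)))))

reduced-numerator-divides : ∀ p q p' q' k → Coprime p' q' → p * q' ≡ k * p' * q → p' ∣ p
reduced-numerator-divides p q p' q' k coprime cross =
  coprime-divisor coprime (divides (k * q) (trans (ℕP.*-comm q' p) (trans cross (regroup k p' q))))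
  where
  regroup : ∀ k p' q → k * p' * q ≡ k * q * p'
  regroup = ℕSolver.solve-∀

multiple-below-double : ∀ {p p'} → p' ∣ p → 1 ≤ p → p < 2 * p' → p ≡ p'
multiple-below-double (divides zero p≡0) 1≤p _ = ⊥-elim (ℕP.<⇒≱ 1≤p (ℕP.≤-reflexive p≡0))
multiple-below-double {p' = p'} (divides (suc zero) p≡p') _ _ = trans p≡p' (ℕP.+-identityʳ p')
multiple-below-double {p' = p'} (divides (suc (suc c)) p≡c+2p') _ p<2p' =
  ⊥-elim (ℕP.<⇒≱ p<2p' (ℕP.≤-trans 2p'≤p (ℕP.≤-reflexive (sym p≡c+2p'))))
  where
  2p'≤p : 2 * p' ≤ p' + (p' + c * p')
  2p'≤p = ℕP.+-monoʳ-≤ p' (ℕP.+-monoʳ-≤ p' (z≤n {c * p'}))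

permutiple-continuant-eq : ∀ k a as b bs → Positive (a ∷ as) → Positive (b ∷ bs) →
                           cf (a ∷ as) ≡ ℕ→ℚ k *ℚ cf (b ∷ bs) →
                           continuant (a ∷ as) < 2 * continuant (b ∷ bs) →
                           continuant (a ∷ as) ≡ continuant (b ∷ bs)
permutiple-continuant-eq k a as b bs pa pb value-eq bound =
  multiple-below-double
    (reduced-numerator-divides _ _ _ _ k (continuants-coprime b bs) (permutiple-cross k a as b bs pa pb value-eq))
    (continuant-pos (a ∷ as) pa) bound

-- The continuant of Defs (expanded from the back) agrees with ours; this is
-- the reversal symmetry of continuants in length 4.
K4≡continuant : ∀ x₀ x₁ x₂ x₃ → K4 x₀ x₁ x₂ x₃ ≡ continuant (x₀ ∷ x₁ ∷ x₂ ∷ x₃ ∷ [])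
K4≡continuant = reverse
  where
  reverse : ∀ x₀ x₁ x₂ x₃ → x₃ * (x₂ * (x₁ * x₀ + 1) + x₀) + (x₁ * x₀ + 1)
                          ≡ x₀ * (x₁ * (x₂ * x₃ + 1) + x₃) + (x₂ * x₃ + 1)
  reverse = ℕSolver.solve-∀

-- K(x₀,x₁,x₂,x₃) grouped by the products u = x₀x₃, v = x₁x₂ that symmetry
-- controls, plus the remaining term x₀x₁ + x₂x₃.
continuant4-expand : ∀ x₀ x₁ x₂ x₃ → continuant (x₀ ∷ x₁ ∷ x₂ ∷ x₃ ∷ [])
                     ≡ (x₀ * x₃) * (x₁ * x₂) + x₀ * x₃ + 1 + (x₀ * x₁ + x₂ * x₃)
continuant4-expand = regroup
  where
  regroup : ∀ x₀ x₁ x₂ x₃ → x₀ * (x₁ * (x₂ * x₃ + 1) + x₃) + (x₂ * x₃ + 1)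
                          ≡ (x₀ * x₃) * (x₁ * x₂) + x₀ * x₃ + 1 + (x₀ * x₁ + x₂ * x₃)
  regroup = ℕSolver.solve-∀

-- For positive x, y: x + y ≤ xy + 1, i.e. (x - 1)(y - 1) ≥ 0.
sum≤product+1 : ∀ {x y} → 1 ≤ x → 1 ≤ y → x + y ≤ x * y + 1
sum≤product+1 {suc x} {suc y} _ _ =
  ℕP.≤-trans (ℕP.m≤m+n (suc x + suc y) (x * y)) (ℕP.≤-reflexive (expand x y))
  where
  expand : ∀ x y → suc x + suc y + x * y ≡ suc x * suc y + 1
  expand = ℕSolver.solve-∀

double-bound : ∀ X u s s' → s ≤ X + 1 → 2 ≤ s' → X + u + 1 + s < 2 * (X + u + 1 + s')
double-bound X u s s' s≤X+1 2≤s' = begin-strict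
  X + u + 1 + s                  <⟨ s≤s (ℕP.+-monoʳ-≤ (X + u + 1) s≤X+1) ⟩
  suc (X + u + 1 + (X + 1))      ≤⟨ ℕP.m≤m+n _ (u + 3) ⟩
  suc (X + u + 1 + (X + 1)) + (u + 3) ≡⟨ double X u ⟩
  2 * (X + u + 1 + 2)            ≤⟨ ℕP.*-monoʳ-≤ 2 (ℕP.+-monoʳ-≤ (X + u + 1) 2≤s') ⟩
  2 * (X + u + 1 + s')           ∎
  where
  open ℕP.≤-Reasoning
  double : ∀ X u → suc (X + u + 1 + (X + 1)) + (u + 3) ≡ 2 * (X + u + 1 + 2)
  double = ℕSolver.solve-∀

symmetric-bound : ∀ {a₀ a₁ a₂ a₃ b₀ b₁ b₂ b₃} →
                  Positive (a₀ ∷ a₁ ∷ a₂ ∷ a₃ ∷ []) → Positive (b₀ ∷ b₁ ∷ b₂ ∷ b₃ ∷ []) →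
                  a₀ * a₃ ≡ b₀ * b₃ → a₁ * a₂ ≡ b₁ * b₂ →
                  continuant (a₀ ∷ a₁ ∷ a₂ ∷ a₃ ∷ []) < 2 * continuant (b₀ ∷ b₁ ∷ b₂ ∷ b₃ ∷ [])
symmetric-bound {a₀} {a₁} {a₂} {a₃} {b₀} {b₁} {b₂} {b₃}
  (p₀ All.∷ p₁ All.∷ p₂ All.∷ p₃ All.∷ All.[])
  (q₀ All.∷ q₁ All.∷ q₂ All.∷ q₃ All.∷ All.[]) u≡ v≡ = begin-strict
    continuant (a₀ ∷ a₁ ∷ a₂ ∷ a₃ ∷ [])          ≡⟨ continuant4-expand a₀ a₁ a₂ a₃ ⟩
    u * v + u + 1 + (a₀ * a₁ + a₂ * a₃)            <⟨ double-bound (u * v) u _ _ outer≤ 2≤inner ⟩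
    2 * (u * v + u + 1 + (b₀ * b₁ + b₂ * b₃))      ≡⟨ cong (2 *_) (cong₂ with-products u≡ v≡) ⟩
    2 * with-products (b₀ * b₃) (b₁ * b₂)          ≡⟨ cong (2 *_) (sym (continuant4-expand b₀ b₁ b₂ b₃)) ⟩
    2 * continuant (b₀ ∷ b₁ ∷ b₂ ∷ b₃ ∷ [])       ∎
  where
  open ℕP.≤-Reasoning
  u = a₀ * a₃
  v = a₁ * a₂
  with-products : ℕ → ℕ → ℕ
  with-products u′ v′ = u′ * v′ + u′ + 1 + (b₀ * b₁ + b₂ * b₃)
  regroup : ∀ a₀ a₁ a₂ a₃ → (a₀ * a₁) * (a₂ * a₃) ≡ (a₀ * a₃) * (a₁ * a₂)
  regroup = ℕSolver.solve-∀
  outer≤ : a₀ * a₁ + a₂ * a₃ ≤ u * v + 1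
  outer≤ = ℕP.≤-trans (sum≤product+1 (ℕP.*-mono-≤ p₀ p₁) (ℕP.*-mono-≤ p₂ p₃))
                      (ℕP.≤-reflexive (cong (_+ 1) (regroup a₀ a₁ a₂ a₃)))
  2≤inner : 2 ≤ b₀ * b₁ + b₂ * b₃
  2≤inner = ℕP.+-mono-≤ (ℕP.*-mono-≤ q₀ q₁) (ℕP.*-mono-≤ q₂ q₃)

digits : (Fin 4 → ℕ) → List ℕ
digits a = a 0F ∷ a 1F ∷ a 2F ∷ a 3F ∷ []

positive-digits : ∀ a → (∀ i → 1 ≤ a i) → Positive (digits a)
positive-digits a pos = pos 0F All.∷ pos 1F All.∷ pos 2F All.∷ pos 3F All.∷ All.[]

theorem15 : (k : ℕ) → 1 < k → (σ : Permutation′ 4) → (a : Fin 4 → ℕ) →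
  (∀ i → 1 ≤ a i) →
  2 ≤ a 3F →
  2 ≤ a (σ ⟨$⟩ʳ 3F) →
  cf (a 0F ∷ a 1F ∷ a 2F ∷ a 3F ∷ [])
    ≡ ℕ→ℚ k *ℚ cf (a (σ ⟨$⟩ʳ 0F) ∷ a (σ ⟨$⟩ʳ 1F) ∷ a (σ ⟨$⟩ʳ 2F) ∷ a (σ ⟨$⟩ʳ 3F) ∷ []) →
  (∀ j → a j * a (opposite j) ≡ a (σ ⟨$⟩ʳ j) * a (σ ⟨$⟩ʳ opposite j)) →
  K4 (a 0F) (a 1F) (a 2F) (a 3F)
    ≡ K4 (a (σ ⟨$⟩ʳ 0F)) (a (σ ⟨$⟩ʳ 1F)) (a (σ ⟨$⟩ʳ 2F)) (a (σ ⟨$⟩ʳ 3F))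
theorem15 k _ σ a pos _ _ value-eq symmetric = begin
  K4 (a 0F) (a 1F) (a 2F) (a 3F)      ≡⟨ K4≡continuant (a 0F) (a 1F) (a 2F) (a 3F) ⟩
  continuant (digits a)               ≡⟨ permutiple-continuant-eq k _ _ _ _ pos-a pos-aσ value-eq bound ⟩
  continuant (digits aσ)              ≡⟨ sym (K4≡continuant (aσ 0F) (aσ 1F) (aσ 2F) (aσ 3F)) ⟩
  K4 (aσ 0F) (aσ 1F) (aσ 2F) (aσ 3F)  ∎
  where
  open ≡-Reasoning
  aσ : Fin 4 → ℕ
  aσ i = a (σ ⟨$⟩ʳ i)
  pos-a : Positive (digits a)
  pos-a = positive-digits a pos
  pos-aσ : Positive (digits aσ)
  pos-aσ = positive-digits aσ (λ i → pos (σ ⟨$⟩ʳ i))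
  bound : continuant (digits a) < 2 * continuant (digits aσ)
  bound = symmetric-bound pos-a pos-aσ (symmetric 0F) (symmetric 1F)
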